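{- Let $\mathbf{L}$ be a Euclidean modal logic and let $\mathcal{F}^\rho_{A,B}$ be a galaxy in $\mathcal{L}_2$. If $\mathbf{N}^{+}\times\{2\}\subseteq\mathtt{S}_{\mathbf{L}}$, then $\mathcal{F}^\rho_{A,B}$ validates $\mathbf{L}$.
   Context: A frame is a pair $(W,R)$ with $W$ non-empty and $R\subseteq W\times W$. Modal formulas are built from propositional variables, $\bot$, $\neg$, $\vee$, $\Box$ with Kripke semantics; validity means truth at every point under every valuation. A (normal) modal logic is a set of modal formulas containing all tautologies and all instances of $\Box(\varphi\to\psi)\to(\Box\varphi\to\Box\psi)$, closed under uniform substitution, modus ponens and necessitation; consistent means not containing $\bot$. A Euclidean modal logic is a consistent modal logic containing $\Diamond\varphi\to\Box\Diamond\varphi$ for all $\varphi$. For disjoint sets $A,B$ with $A\cup B\neq\emptyset$ and $\rho:A\to\mathcal{P}(B)$, the galaxy $\mathcal{F}^\rho_{A,B}$ is the frame with universe $A\cup B$ and relation $\bigcup_{s\in A}(\{s\}\times\rho(s))\cup(B\times B)$. $\mathcal{L}_2$ is the class of galaxies with $|A|\geq4$, $|B|\geq4$ and $|B\setminus\rho(s)|=2$ for all $s\in A$. $\mathbf{N}^{+}=\mathbb{N}\setminus\{0\}$, $\mathbf{N}^{ - }=\mathbb{N}\cup\{ -1\}$. For $m\in\mathbf{N}^{+}$, $n\in\mathbf{N}^{ - }$ the flower $\mathcal{F}_m^n$ is: if $n\in\mathbb{N}$, universe $\{0,\dots,m+n\}$ with relation $(\{0\}\times\{1,\dots,m\})\cup(\{1,\dots,m+n\}\times\{1,\dots,m+n\})$;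 if $n=-1$, universe $\{1,\dots,m\}$ with the universal relation. $\mathtt{S}_{\mathbf{L}}=\{(m,n)\in\mathbf{N}^{+}\times\mathbf{N}^{ - }:\mathcal{F}_m^n\text{ validates }\mathbf{L}\}$. -}

module Defs where

open import Data.Nat using (ℕ; zero; suc; _+_; _≤_)
open import Data.Fin using (Fin; toℕ)
open import Data.Bool using (Bool; true; false; not; _∨_)
open import Data.Empty using (⊥)
open import Data.Unit using (⊤)
open import Data.Product using (Σ; _×_; ∃; _,_)
open import Data.Sum using (_⊎_; inj₁; inj₂)
open import Relation.Nullary using (¬_)
open import Relation.Binary.PropositionalEquality using (_≡_; _≢_)

infixr 6 _∨'_
infixr 5 _⇒_

data Formula : Set where
  var  : ℕ → Formula
  ⊥'   : Formula
  ¬'_  : Formula → Formula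
  _∨'_ : Formula → Formula → Formula
  □_   : Formula → Formula

_⇒_ : Formula → Formula → Formula
φ ⇒ ψ = (¬' φ) ∨' ψ

◇_ : Formula → Formula
◇ φ = ¬' (□ (¬' φ))

-- Frames and Kripke semantics (classical, via a negative rendering so
-- that every truth value is ¬¬-stable: disjunction is the classical one)

record Frame : Set₁ where
  field
    W : Set
    R : W → W → Set
open Frame public

Valuation : Set → Set
Valuation W = ℕ → W → Bool

Sat : (F : Frame) → Valuation (W F) → W F → Formula → Set
Sat F V w (var p)  = V p w ≡ true
Sat F V w ⊥'       = ⊥
Sat F V w (¬' φ)   = ¬ Sat F V w φ
Sat F V w (φ ∨' ψ) = ¬ (¬ Sat F V w φ × ¬ Sat F V w ψ)
Sat F V w (□ φ)    = ∀ v → R F w v → Sat F V v φ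

Valid : Frame → Formula → Set
Valid F φ = ∀ (V : Valuation (W F)) (w : W F) → Sat F V w φ

Validates : Frame → (Formula → Set) → Set
Validates F L = ∀ φ → L φ → Valid F φ

-- Boolean evaluation treating variables and □-formulas as atoms;
-- a tautology (substitution instance of a propositional tautology)
-- is a formula true under every such assignment.
evalB : (Formula → Bool) → Formula → Bool
evalB f (var p)  = f (var p)
evalB f ⊥'       = false
evalB f (¬' φ)   = not (evalB f φ)
evalB f (φ ∨' ψ) = evalB f φ ∨ evalB f ψ
evalB f (□ φ)    = f (□ φ)

Tautology : Formula → Set
Tautology φ = ∀ (f : Formula → Bool) → evalB f φ ≡ true

substF : (ℕ → Formula) → Formula → Formula
substF σ (var p)  = σ p
substF σ ⊥'       = ⊥'
substF σ (¬' φ)   = ¬' substF σ φ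
substF σ (φ ∨' ψ) = substF σ φ ∨' substF σ ψ
substF σ (□ φ)    = □ substF σ φ

record ModalLogic (L : Formula → Set) : Set where
  field
    taut  : ∀ φ → Tautology φ → L φ
    axK   : ∀ φ ψ → L (□ (φ ⇒ ψ) ⇒ ((□ φ) ⇒ (□ ψ)))
    usub  : ∀ σ φ → L φ → L (substF σ φ)
    mp    : ∀ φ ψ → L φ → L (φ ⇒ ψ) → L ψ
    nec   : ∀ φ → L φ → L (□ φ)

Consistent : (Formula → Set) → Set
Consistent L = ¬ L ⊥'

record EuclideanLogic (L : Formula → Set) : Set where
  field
    modal      : ModalLogic L
    consistent : Consistent L
    axE        : ∀ φ → L ((◇ φ) ⇒ (□ (◇ φ)))

-- Galaxies F^ρ_{A,B}: universe A ⊎ B (disjoint union), ρ(s) ⊆ B given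
-- by its characteristic function.

galaxy : (A B : Set) → (A → B → Bool) → Frame
galaxy A B ρ = record { W = A ⊎ B ; R = rel }
  where
  rel : A ⊎ B → A ⊎ B → Set
  rel (inj₁ s) (inj₁ _) = ⊥
  rel (inj₁ s) (inj₂ b) = ρ s b ≡ true
  rel (inj₂ _) (inj₁ _) = ⊥
  rel (inj₂ _) (inj₂ _) = ⊤

AtLeast4 : Set → Set
AtLeast4 X = Σ (Fin 4 → X) λ f → ∀ i j → f i ≡ f j → i ≡ j

ComplementHas2 : (B : Set) → (B → Bool) → Set
ComplementHas2 B P =
  Σ B λ b₁ → Σ B λ b₂ →
    b₁ ≢ b₂ × P b₁ ≡ false × P b₂ ≡ false ×
    (∀ b → P b ≡ false → b ≡ b₁ ⊎ b ≡ b₂)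

InL2 : (A B : Set) → (A → B → Bool) → Set
InL2 A B ρ = AtLeast4 A × AtLeast4 B × (∀ s → ComplementHas2 B (ρ s))

-- Flowers F^n_m, m ∈ N⁺, n ∈ N⁻ = ℕ ∪ {-1}

data ℕ⁻ : Set where
  minus1 : ℕ⁻
  nat    : ℕ → ℕ⁻

flower : ℕ → ℕ⁻ → Frame
flower m minus1  = record { W = Fin m ; R = λ _ _ → ⊤ }
flower m (nat n) = record { W = Fin (suc (m + n)) ; R = rel }
  where
  rel : Fin (suc (m + n)) → Fin (suc (m + n)) → Set
  rel i j = (toℕ i ≡ 0 × 1 ≤ toℕ j × toℕ j ≤ m)
          ⊎ (1 ≤ toℕ i × 1 ≤ toℕ j)

S : (Formula → Set) → ℕ → ℕ⁻ → Set
S L m n = 1 ≤ m × Validates (flower m n) L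

{-# OPTIONS --safe #-}
-- Fix s ∈ A and a valuation V. For a formula φ choose finitely many points ws of ρ(s) such that
-- every boxed subformula □χ of φ refuted somewhere in ρ(s) is refuted at one of them (a classical
-- choice, so only available under ¬¬). Sending the root of the flower F_m^2 to s, its petals onto
-- ws and its two remaining points onto B ∖ ρ(s) preserves the relation and reflects it for
-- exactly these refutations, so every subformula of □φ keeps its truth value along the map.
-- As F_m^2 validates φ, hence □φ, φ holds at s and, via □φ at a cluster point, on all of B.
module Submission where

open import Defs
open import Data.Nat using (ℕ; suc; _≤_; _<_; z≤n; s≤s)
open import Data.Bool using (Bool; true; false; _≟_)
open import Data.Bool.Properties using (¬-not)
open import Data.Unit using (⊤; tt)
open import Data.Fin using (Fin; _↑ˡ_; _↑ʳ_) renaming (zero to 0F; suc to sucF)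
open import Data.Fin.Properties using (any?; injective⇒≤; toℕ<n; toℕ-↑ˡ)
open import Data.Fin.Patterns using (1F)
open import Data.Product using (∃₂; ∃-syntax; _×_; _,_; proj₁; proj₂)
open import Data.Product.Function.NonDependent.Propositional using (_×-⇔_)
open import Data.Sum using (_⊎_; inj₁; inj₂; [_,_]′)
open import Data.Vec using (Vec; []; _∷_; _++_; lookup)
open import Data.Vec.Properties using (lookup-++ˡ; lookup-++ʳ; lookup-++-<)
open import Data.Vec.Relation.Unary.All using (All; []; _∷_)
open import Data.Vec.Relation.Unary.All.Properties using (lookup⁺; ++⁺)
open import Data.Vec.Relation.Unary.Any as Any using (Any; here; there)
open import Data.Vec.Relation.Unary.Any.Properties using (lookup-index; ++⁺ˡ; ++⁺ʳ)
open import Function using (_∘_; const; _⇔_; mk⇔; Equivalence)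
open import Function.Construct.Identity using (⇔-id)
open import Function.Related.TypeIsomorphisms using (¬-cong-⇔)
open import Relation.Nullary using (¬_; yes; no; contradiction; ¬¬-map)
open import Relation.Nullary.Decidable using (¬¬-excluded-middle)
open import Relation.Binary.PropositionalEquality using (_≡_; refl; sym; trans; cong; subst)
open import Relation.Unary using (Pred)

open Equivalence using (to; from)

Sat-stable : ∀ {F V w} φ → ¬ ¬ Sat F V w φ → Sat F V w φ
Sat-stable {V = V} {w} (var p) ¬¬φ with V p w
... | true  = refl
... | false = contradiction (λ ()) ¬¬φ
Sat-stable ⊥'       ¬¬φ   = ¬¬φ (λ ())
Sat-stable (¬' φ)   ¬¬¬φ  = λ φ → ¬¬¬φ (λ ¬φ → ¬φ φ)
Sat-stable (φ ∨' ψ) ¬¬φ∨ψ = λ ¬φ×¬ψ → ¬¬φ∨ψ (λ φ∨ψ → φ∨ψ ¬φ×¬ψ)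
Sat-stable (□ φ)    ¬¬□φ  = λ v wRv → Sat-stable φ (λ ¬φ → ¬¬□φ (λ □φ → ¬φ (□φ v wRv)))

Valid-□ : ∀ {F φ} → Valid F φ → Valid F (□ φ)
Valid-□ valid V _ v _ = valid V v

AllBoxes : (Formula → Set) → Formula → Set
AllBoxes P (var _)  = ⊤
AllBoxes P ⊥'       = ⊤
AllBoxes P (¬' φ)   = AllBoxes P φ
AllBoxes P (φ ∨' ψ) = AllBoxes P φ × AllBoxes P ψ
AllBoxes P (□ φ)    = AllBoxes P φ × P φ

AllBoxes-map : ∀ {P Q : Formula → Set} → (∀ {φ} → P φ → Q φ) → ∀ φ → AllBoxes P φ → AllBoxes Q φ
AllBoxes-map f (var _)  _           = tt
AllBoxes-map f ⊥'       _           = tt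
AllBoxes-map f (¬' φ)   Pφ          = AllBoxes-map f φ Pφ
AllBoxes-map f (φ ∨' ψ) (Pφ , Pψ)   = AllBoxes-map f φ Pφ , AllBoxes-map f ψ Pψ
AllBoxes-map f (□ φ)    (Pφ , Pφ′)  = AllBoxes-map f φ Pφ , f Pφ′

module Transfer {F G : Frame} (f : W F → W G) (V : Valuation (W G)) where

  V∘f : Valuation (W F)
  V∘f p x = V p (f x)

  Forth : Set
  Forth = ∀ {x y} → R F x y → R G (f x) (f y)

  Back : Formula → Set
  Back φ = ∀ x v → R G (f x) v → ¬ Sat G V v φ → ∃[ y ] R F x y × ¬ Sat G V (f y) φ

  Sat-transfer : Forth → ∀ φ → AllBoxes Back φ → ∀ x → Sat F V∘f x φ ⇔ Sat G V (f x) φ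
  Sat-transfer forth (var p)  _ x = ⇔-id _
  Sat-transfer forth ⊥'       _ x = ⇔-id _
  Sat-transfer forth (¬' φ)   b x = ¬-cong-⇔ (Sat-transfer forth φ b x)
  Sat-transfer forth (φ ∨' ψ) (bφ , bψ) x =
    ¬-cong-⇔ (¬-cong-⇔ (Sat-transfer forth φ bφ x) ×-⇔ ¬-cong-⇔ (Sat-transfer forth ψ bψ x))
  Sat-transfer forth (□ φ) (bφ , back) x = mk⇔ preserve reflect
    where
    ih : ∀ y → Sat F V∘f y φ ⇔ Sat G V (f y) φ
    ih = Sat-transfer forth φ bφ

    preserve : Sat F V∘f x (□ φ) → Sat G V (f x) (□ φ)
    preserve □φ v fxRv = Sat-stable φ λ ¬φv →
      let (y , xRy , ¬φfy) = back x v fxRv ¬φv in ¬φfy (to (ih y) (□φ y xRy))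

    reflect : Sat G V (f x) (□ φ) → Sat F V∘f x (□ φ)
    reflect □φ y xRy = from (ih y) (□φ (f y) (forth xRy))

  Valid-transfer : Forth → ∀ φ → AllBoxes Back φ → Valid F φ → ∀ x → Sat G V (f x) φ
  Valid-transfer forth φ back valid x = to (Sat-transfer forth φ back x) (valid V∘f x)

ComplementHas2⇒∃-true : ∀ {B P} → AtLeast4 B → ComplementHas2 B P → ∃[ b ] P b ≡ true
ComplementHas2⇒∃-true {P = P} (f , f-injective) (b₁ , b₂ , _ , _ , _ , outside)
  with any? (λ i → P (f i) ≟ true)
... | yes (i , Pfi) = f i , Pfi
... | no ∄          = contradiction (injective⇒≤ side-injective) λ { (s≤s (s≤s ())) }
  where
  between : ∀ i → f i ≡ b₁ ⊎ f i ≡ b₂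
  between i = outside (f i) (¬-not (∄ ∘ (i ,_)))

  side : ∀ {b} → b ≡ b₁ ⊎ b ≡ b₂ → Fin 2
  side = [ const 0F , const 1F ]′

  side-injective : ∀ {i j} → side (between i) ≡ side (between j) → i ≡ j
  side-injective {i} {j} with between i | between j
  ... | inj₁ p | inj₁ q = λ _ → f-injective i j (trans p (sym q))
  ... | inj₂ p | inj₂ q = λ _ → f-injective i j (trans p (sym q))
  ... | inj₁ _ | inj₂ _ = λ ()
  ... | inj₂ _ | inj₁ _ = λ ()

module Galaxy {A B : Set} (ρ : A → B → Bool) (V : Valuation (A ⊎ B)) (s : A) {b₁ b₂ : B}
              (outside : ∀ b → ρ s b ≡ false → b ≡ b₁ ⊎ b ≡ b₂) where

  G : Frame
  G = galaxy A B ρ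

  Refutes : Formula → B → Set
  Refutes φ b = ¬ Sat G V (inj₂ b) φ

  Witnessed : ∀ {m} → Vec B m → Formula → Set
  Witnessed ws φ = ∀ b → ρ s b ≡ true → Refutes φ b → Any (Refutes φ) ws

  Witnessed-mono : ∀ {m n} {ws : Vec B m} {vs : Vec B n} →
                   (∀ {P : Pred B _} → Any P ws → Any P vs) →
                   ∀ φ → AllBoxes (Witnessed ws) φ → AllBoxes (Witnessed vs) φ
  Witnessed-mono ws⊆vs = AllBoxes-map λ witnessed b ρsb ¬φb → ws⊆vs (witnessed b ρsb ¬φb)

  Witnesses : Formula → Set
  Witnesses φ = ∃₂ λ m (ws : Vec B m) → All (λ b → ρ s b ≡ true) ws × AllBoxes (Witnessed ws) φ

  witnesses : ∀ φ → ¬ ¬ Witnesses φ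
  witnesses (var _) k = k (_ , [] , [] , tt)
  witnesses ⊥'      k = k (_ , [] , [] , tt)
  witnesses (¬' φ)    = witnesses φ
  witnesses (φ ∨' ψ) k =
    witnesses φ λ (_ , ws , ws⊆ρs , wφ) → witnesses ψ λ (_ , vs , vs⊆ρs , wψ) →
    k (_ , ws ++ vs , ++⁺ ws⊆ρs vs⊆ρs , Witnessed-mono ++⁺ˡ φ wφ , Witnessed-mono (++⁺ʳ ws) ψ wψ)
  witnesses (□ φ) k =
    witnesses φ λ (_ , ws , ws⊆ρs , wφ) →
    ¬¬-excluded-middle {A = ∃[ b ] ρ s b ≡ true × Refutes φ b} λ where
      (yes (b , ρsb , ¬φb)) →
        k (_ , b ∷ ws , ρsb ∷ ws⊆ρs , Witnessed-mono there φ wφ , λ _ _ _ → here ¬φb)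
      (no ∄) →
        k (_ , ws , ws⊆ρs , wφ , λ b ρsb ¬φb → contradiction (b , ρsb , ¬φb) ∄)

  module FlowerMap {m} (ws : Vec B m) (ws⊆ρs : All (λ b → ρ s b ≡ true) ws) where

    Flower : Frame
    Flower = flower m (nat 2)

    flower-map : W Flower → A ⊎ B
    flower-map 0F       = inj₁ s
    flower-map (sucF i) = inj₂ (lookup (ws ++ b₁ ∷ b₂ ∷ []) i)

    petal : Fin m → W Flower
    petal i = sucF (i ↑ˡ 2)

    hidden : Fin 2 → W Flower
    hidden k = sucF (m ↑ʳ k)

    flower-map-petal : ∀ i → flower-map (petal i) ≡ inj₂ (lookup ws i)
    flower-map-petal i = cong inj₂ (lookup-++ˡ ws _ i)

    flower-map-hidden : ∀ k → flower-map (hidden k) ≡ inj₂ (lookup (b₁ ∷ b₂ ∷ []) k)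
    flower-map-hidden k = cong inj₂ (lookup-++ʳ ws _ k)

    root-sees-petal : ∀ i → R Flower 0F (petal i)
    root-sees-petal i = inj₁ (refl , s≤s z≤n , subst (_< m) (sym (toℕ-↑ˡ i 2)) (toℕ<n i))

    cluster-sees : ∀ i j → R Flower (sucF i) (sucF j)
    cluster-sees _ _ = inj₂ (s≤s z≤n , s≤s z≤n)

    open Transfer {Flower} {G} flower-map V using (Forth; Back)

    forth : Forth
    forth {0F}     {0F}     (inj₁ (_ , () , _))
    forth {0F}     {sucF i} (inj₁ (_ , _ , i<m)) =
      subst (λ b → ρ s b ≡ true) (sym (lookup-++-< ws _ i i<m)) (lookup⁺ ws⊆ρs _)
    forth {0F}     {_}      (inj₂ (() , _))
    forth {sucF _} {_}      (inj₁ (() , _))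
    forth {sucF _} {0F}     (inj₂ (_ , ()))
    forth {sucF _} {sucF _} (inj₂ _) = tt

    petal-refuting : ∀ {φ} → Any (Refutes φ) ws → ∃[ i ] ¬ Sat G V (flower-map (petal i)) φ
    petal-refuting {φ} p =
      Any.index p , subst (λ x → ¬ Sat G V x φ) (sym (flower-map-petal _)) (lookup-index p)

    hidden-refuting : ∀ {φ} k → Refutes φ (lookup (b₁ ∷ b₂ ∷ []) k) →
                      ¬ Sat G V (flower-map (hidden k)) φ
    hidden-refuting {φ} k = subst (λ x → ¬ Sat G V x φ) (sym (flower-map-hidden k))

    back : ∀ {φ} → Witnessed ws φ → Back φ
    back witnessed 0F (inj₂ b) ρsb ¬φb =
      let (i , ¬φi) = petal-refuting (witnessed b ρsb ¬φb) in petal i , root-sees-petal i , ¬φi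
    back witnessed (sucF j) (inj₂ b) _ ¬φb with ρ s b in ρsb
    ... | true =
      let (i , ¬φi) = petal-refuting (witnessed b ρsb ¬φb) in petal i , cluster-sees j _ , ¬φi
    ... | false with outside b ρsb
    ...   | inj₁ refl = hidden 0F , cluster-sees j _ , hidden-refuting 0F ¬φb
    ...   | inj₂ refl = hidden 1F , cluster-sees j _ , hidden-refuting 1F ¬φb

  -- The extra petal d guarantees m ≥ 1, the only sizes for which flowers are assumed to validate L.
  Sat-of-Witnesses : ∀ {d} → ρ s d ≡ true → ∀ φ → (∀ m → Valid (flower (suc m) (nat 2)) φ) →
                     Witnesses (□ φ) → Sat G V (inj₁ s) φ × (∀ b → Sat G V (inj₂ b) φ)
  Sat-of-Witnesses {d} ρsd φ valid (_ , ws , ws⊆ρs , witnessed) =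
    Sat-φ 0F , λ b → Sat-□φ (sucF 0F) (inj₂ b) tt
    where
    open FlowerMap (d ∷ ws) (ρsd ∷ ws⊆ρs)
    open Transfer {Flower} {G} flower-map V using (Back; Valid-transfer)

    backs : AllBoxes Back (□ φ)
    backs = AllBoxes-map back (□ φ) (Witnessed-mono there (□ φ) witnessed)

    Sat-φ : ∀ x → Sat G V (flower-map x) φ
    Sat-φ = Valid-transfer forth φ (proj₁ backs) (valid _)

    Sat-□φ : ∀ x → Sat G V (flower-map x) (□ φ)
    Sat-□φ = Valid-transfer forth (□ φ) backs (Valid-□ {φ = φ} (valid _))

  Sat-root-and-cluster : ∀ {d} → ρ s d ≡ true → ∀ φ → (∀ m → Valid (flower (suc m) (nat 2)) φ) →
                         Sat G V (inj₁ s) φ × (∀ b → Sat G V (inj₂ b) φ)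
  Sat-root-and-cluster ρsd φ valid =
      Sat-stable φ (¬¬-map (proj₁ ∘ Sat-of-Witnesses ρsd φ valid) (witnesses (□ φ)))
    , λ b → Sat-stable φ (¬¬-map (λ w → proj₂ (Sat-of-Witnesses ρsd φ valid w) b) (witnesses (□ φ)))

lemma37 : (L : Formula → Set) → EuclideanLogic L →
          (A B : Set) (ρ : A → B → Bool) → InL2 A B ρ →
          (∀ (m : ℕ) → 1 ≤ m → S L m (nat 2)) →
          Validates (galaxy A B ρ) L
lemma37 L _ A B ρ ((a , _) , B⁴ , complement₂) flowers φ Lφ V = Sat-everywhere
  where
  valid : ∀ m → Valid (flower (suc m) (nat 2)) φ
  valid m = proj₂ (flowers (suc m) (s≤s z≤n)) φ Lφ

  Sat-root-and-cluster : ∀ s → Sat (galaxy A B ρ) V (inj₁ s) φ ×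
                               (∀ b → Sat (galaxy A B ρ) V (inj₂ b) φ)
  Sat-root-and-cluster s =
    let (_ , _ , _ , _ , _ , outside) = complement₂ s
        (_ , ρsd) = ComplementHas2⇒∃-true B⁴ (complement₂ s)
    in Galaxy.Sat-root-and-cluster ρ V s outside ρsd φ valid

  Sat-everywhere : ∀ w → Sat (galaxy A B ρ) V w φ
  Sat-everywhere (inj₁ s) = proj₁ (Sat-root-and-cluster s)
  Sat-everywhere (inj₂ b) = proj₂ (Sat-root-and-cluster (a 0F)) b
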